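{- Let $k\geq 2$ and $n,m$ be positive integers. Let $G$ be a finite simple graph with $n^2$ vertices and $O\chi_k(G)=n$, and let $H$ be a finite simple graph with $m^2$ vertices and $O\chi_k(H)=m$. Then $O\chi_k(G\times H)=nm$.
   Context: Two vertex colourings $c,c'$ of a graph are orthogonal if no two distinct vertices $u\neq v$ satisfy both $c(u)=c(v)$ and $c'(u)=c'(v)$. A $k$-orthogonal colouring of a graph is a collection of $k$ proper vertex colourings that are pairwise orthogonal. The $k$-orthogonal chromatic number $O\chi_k(G)$ is the minimum $N$ such that $G$ has a $k$-orthogonal colouring in which every colouring uses colours from a set of $N$ colours. The tensor product $G\times H$ has vertex set $V(G)\times V(H)$, with $(u_1,v_1)$ adjacent to $(u_2,v_2)$ if and only if $u_1u_2\in E(G)$ and $v_1v_2\in E(H)$. -}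

module Defs where

open import Level using (0ℓ)
open import Data.Nat using (ℕ; _≤_)
open import Data.Fin using (Fin)
open import Data.Product using (_×_; _,_)
open import Relation.Nullary using (¬_)
open import Relation.Binary.PropositionalEquality using (_≡_)

record Graph (V : Set) : Set₁ where
  field
    Adj   : V → V → Set
    irrefl : ∀ {u} → ¬ Adj u u
    sym    : ∀ {u v} → Adj u v → Adj v u
open Graph public

_⊗_ : ∀ {V W} → Graph V → Graph W → Graph (V × W)
G ⊗ H = record
  { Adj = λ { (u₁ , v₁) (u₂ , v₂) → Adj G u₁ u₂ × Adj H v₁ v₂ }
  ; irrefl = λ { (a , b) → irrefl G a }
  ; sym = λ { (a , b) → sym G a , sym H b }
  }

IsProper : ∀ {V} → Graph V → ∀ {N} → (V → Fin N) → Set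
IsProper G c = ∀ {u v} → Adj G u v → ¬ c u ≡ c v

Orthogonal : ∀ {V N} → (V → Fin N) → (V → Fin N) → Set
Orthogonal {V} c c' = ∀ (u v : V) → ¬ u ≡ v → ¬ (c u ≡ c v × c' u ≡ c' v)

record OrthColouring {V} (G : Graph V) (k N : ℕ) : Set where
  field
    col    : Fin k → V → Fin N
    proper : ∀ i → IsProper G (col i)
    orth   : ∀ i j → ¬ i ≡ j → Orthogonal (col i) (col j)

OChi≡ : ∀ {V} → Graph V → ℕ → ℕ → Set
OChi≡ G k N = OrthColouring G k N × (∀ M → OrthColouring G k M → N ≤ M)

-- Pairing the colours of the i-th colourings of G and H gives a k-orthogonal
-- colouring of G ⊗ H with nm colours. Conversely, two orthogonal colourings
-- with M colours pair into an injection of the vertices into the M² colour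
-- pairs, so (nm)² = |V(G ⊗ H)| ≤ M². Only the existence halves of
-- O χ_k(G) = n and O χ_k(H) = m are used.
module Submission where

open import Defs
open import Data.Nat using (ℕ; _*_; _≤_; s≤s)
open import Data.Nat.Properties
  using (module ≤-Reasoning; ≮⇒≥; <⇒≱; *-mono-<; [m*n]*[o*p]≡[m*o]*[n*p])
open import Data.Fin using (Fin; zero; suc; combine; remQuot)
open import Data.Fin.Properties
  using (_≟_; combine-injective; combine-remQuot; injective⇒≤)
open import Data.Product using (_×_; _,_; proj₁; uncurry)
open import Function using (_∘_; Injective)
open import Relation.Nullary using (¬_)
open import Relation.Nullary.Decidable using (decidable-stable)
open import Relation.Binary.PropositionalEquality
  using (_≡_; cong; cong₂; trans) renaming (sym to ≡-sym)

private
  variable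
    V W : Set
    k n m N M : ℕ

_⊠_ : (V → Fin n) → (W → Fin m) → V × W → Fin (n * m)
(c ⊠ d) (u , v) = combine (c u) (d v)

⊠-proper : (G : Graph V) (H : Graph W) {c : V → Fin n} (d : W → Fin m) →
           IsProper G c → IsProper (G ⊗ H) (c ⊠ d)
⊠-proper G H {c} d c-proper {u , v} {u′ , v′} (uu′ , _) cu≡cu′ =
  c-proper uu′ (proj₁ (combine-injective (c u) (d v) (c u′) (d v′) cu≡cu′))

orthogonal⇒¬¬≡ : {c c′ : V → Fin n} → Orthogonal c c′ →
                 ∀ {u v} → c u ≡ c v → c′ u ≡ c′ v → ¬ ¬ u ≡ v
orthogonal⇒¬¬≡ c⊥c′ cu≡cv c′u≡c′v u≢v = c⊥c′ _ _ u≢v (cu≡cv , c′u≡c′v)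

⊠-orthogonal : {c c′ : V → Fin n} {d d′ : W → Fin m} →
               Orthogonal c c′ → Orthogonal d d′ → Orthogonal (c ⊠ d) (c′ ⊠ d′)
⊠-orthogonal {c = c} {c′} {d} {d′} c⊥c′ d⊥d′ (u , v) (u′ , v′) uv≢u′v′ (e , e′)
  with cu≡cu′ , dv≡dv′ ← combine-injective (c u) (d v) (c u′) (d v′) e
     | c′u≡c′u′ , d′v≡d′v′ ← combine-injective (c′ u) (d′ v) (c′ u′) (d′ v′) e′ =
  orthogonal⇒¬¬≡ c⊥c′ cu≡cu′ c′u≡c′u′ λ u≡u′ →
  orthogonal⇒¬¬≡ d⊥d′ dv≡dv′ d′v≡d′v′ λ v≡v′ →
  uv≢u′v′ (cong₂ _,_ u≡u′ v≡v′)

⊗-orthColouring : {G : Graph V} {H : Graph W} →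
                  OrthColouring G k n → OrthColouring H k m →
                  OrthColouring (G ⊗ H) k (n * m)
⊗-orthColouring {G = G} {H} χ ψ = record
  { col    = λ i → col χ i ⊠ col ψ i
  ; proper = λ i → ⊠-proper G H (col ψ i) (proper χ i)
  ; orth   = λ i j i≢j → ⊠-orthogonal (orth χ i j i≢j) (orth ψ i j i≢j)
  }
  where open OrthColouring

-- The ¬¬ from orthogonality is removed by decidability of equality on Fin N.
orthogonal⇒≤ : (ι : Fin N → V) → Injective _≡_ _≡_ ι →
               {c c′ : V → Fin M} → Orthogonal c c′ → N ≤ M * M
orthogonal⇒≤ ι ι-injective {c} {c′} c⊥c′ = injective⇒≤ pair-injective
  where
  pair-injective : Injective _≡_ _≡_ (λ x → combine (c (ι x)) (c′ (ι x)))
  pair-injective {x} {y} e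
    with cιx≡cιy , c′ιx≡c′ιy ← combine-injective (c (ι x)) (c′ (ι x)) (c (ι y)) (c′ (ι y)) e =
    decidable-stable (x ≟ y) λ x≢y →
      orthogonal⇒¬¬≡ c⊥c′ cιx≡cιy c′ιx≡c′ιy (x≢y ∘ ι-injective)

orthColouring⇒≤ : {G : Graph V} → 2 ≤ k → (ι : Fin N → V) → Injective _≡_ _≡_ ι →
                  OrthColouring G k M → N ≤ M * M
orthColouring⇒≤ (s≤s (s≤s _)) ι ι-injective χ =
  orthogonal⇒≤ ι ι-injective (OrthColouring.orth χ zero (suc zero) λ ())

remQuot-injective : Injective _≡_ _≡_ (remQuot {n} m)
remQuot-injective {n} {m} {x} {y} e =
  trans (≡-sym (combine-remQuot {n} m x))
        (trans (cong (uncurry combine) e) (combine-remQuot {n} m y))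

m*m≤n*n⇒m≤n : ∀ {m n} → m * m ≤ n * n → m ≤ n
m*m≤n*n⇒m≤n mm≤nn = ≮⇒≥ λ n<m → <⇒≱ (*-mono-< n<m n<m) mm≤nn

mainTheorem4 : (k n m : ℕ) → 2 ≤ k → 1 ≤ n → 1 ≤ m →
    (G : Graph (Fin (n * n))) → (H : Graph (Fin (m * m))) →
    OChi≡ G k n → OChi≡ H k m → OChi≡ (G ⊗ H) k (n * m)
mainTheorem4 k n m 2≤k _ _ G H (χ , _) (ψ , _) =
  ⊗-orthColouring χ ψ , λ M θ → m*m≤n*n⇒m≤n (vertexBound M θ)
  where
  open ≤-Reasoning
  vertexBound : ∀ M → OrthColouring (G ⊗ H) k M → n * m * (n * m) ≤ M * M
  vertexBound M θ = begin
    n * m * (n * m)   ≡⟨ [m*n]*[o*p]≡[m*o]*[n*p] n m n m ⟩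
    n * n * (m * m)   ≤⟨ orthColouring⇒≤ 2≤k (remQuot (m * m)) remQuot-injective θ ⟩
    M * M             ∎
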